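{- Let $p$ be a prime and $m\geq 3$ an integer with $\gcd(p,m)=1$ and $\gcd(p-1,m)=1$. Let $\ell=\min\{e\geq 1:\gcd(p^e-1,m)>1\}$, $m'=\gcd(p^\ell-1,m)$, and $s=(p^{\ell-1}+\cdots+p+1)/m'$ (an integer). If $s>1$, then $s\geq \ell$, except possibly when $p=2$ and $\ell\in\{4,6,8,9\}$. -}

module Defs where

open import Data.Nat using (ℕ; zero; suc; _+_; _^_)

geomSum : ℕ → ℕ → ℕ
geomSum p zero    = 0
geomSum p (suc n) = p ^ n + geomSum p n

{-# OPTIONS --safe #-}
-- Write M = gcd (p ^ ℓ ∸ 1) m and G = geomSum p ℓ.  M divides (p - 1) G and is coprime
-- to p - 1, so M ∣ G.  Now let s M = G with 1 < s < ℓ.  If ℓ is prime, s ∣ p ^ ℓ - 1, and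
-- by pigeonhole p ^ d ≡ 1 (mod s) for some 1 ≤ d ≤ s; as d is coprime to ℓ, Bézout gives
-- p ≡ 1 (mod s), whence G ≡ ℓ (mod s) and s ∣ ℓ, which is absurd.  If ℓ is composite,
-- every proper divisor a of ℓ has geomSum p a ∣ G, and geomSum p a is coprime to M since it
-- divides p ^ a - 1, which by minimality of ℓ is coprime to m; hence geomSum p a ≤ s.
-- Writing ℓ = x y with 2 ≤ y ≤ x gives ℓ ≤ x² ≤ 2 ^ x - 1 ≤ s for x ≥ 5, and of the
-- remaining ℓ ∈ {4, 6, 8, 9, 12, 16} only ℓ = 4 and ℓ = 9 with p = 2 escape the bound.

module Submission where

open import Defs
open import Data.Nat.Base
open import Data.Nat.Properties
open import Data.Nat.Divisibility
open import Data.Nat.DivMod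
open import Data.Nat.GCD using (gcd; gcd[m,n]∣m; gcd[m,n]∣n; gcd[m,n]≢0; module Bézout)
open import Data.Nat.Coprimality
  using (Coprime; coprime-divisor; coprime-Bézout; gcd≡1⇒coprime; prime⇒coprime)
  renaming (sym to coprime-sym)
open import Data.Nat.Primality
  using (Prime; Composite; composite; prime?; ¬prime⇒composite; prime⇒¬composite; prime⇒nonZero; ¬prime[0]; ¬prime[1])
open import Data.Fin.Base using (toℕ; fromℕ<)
open import Data.Fin.Properties using (pigeonhole; toℕ-fromℕ<; toℕ≤pred[n])
open import Data.Product using (_×_; _,_; ∃; ∃₂)
open import Data.Sum using (_⊎_; inj₁; inj₂)
open import Data.Empty using (⊥-elim)
open import Relation.Nullary using (yes; no)
open import Relation.Binary.PropositionalEquality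
open import Data.Nat.Solver using (module +-*-Solver)
open +-*-Solver using (solve; _:+_; _:*_; _:=_; con)

geomSum-*-pred+1 : ∀ c n → geomSum (suc c) n * c + 1 ≡ suc c ^ n
geomSum-*-pred+1 c zero = refl
geomSum-*-pred+1 c (suc n) = begin
  (p ^ n + geomSum p n) * c + 1     ≡⟨ cong (_+ 1) (*-distribʳ-+ c (p ^ n) _) ⟩
  p ^ n * c + geomSum p n * c + 1   ≡⟨ +-assoc (p ^ n * c) _ 1 ⟩
  p ^ n * c + (geomSum p n * c + 1) ≡⟨ cong (p ^ n * c +_) (geomSum-*-pred+1 c n) ⟩
  p ^ n * c + p ^ n                 ≡⟨ +-comm (p ^ n * c) (p ^ n) ⟩
  p ^ n + p ^ n * c                 ≡⟨ cong (p ^ n +_) (*-comm (p ^ n) c) ⟩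
  p ^ suc n                         ∎
  where
  open ≡-Reasoning
  p = suc c

geomSum-*-pred : ∀ p n → geomSum p n * (p ∸ 1) ≡ p ^ n ∸ 1
geomSum-*-pred zero zero = refl
geomSum-*-pred zero (suc n) = *-zeroʳ (geomSum 0 (suc n))
geomSum-*-pred (suc c) n = sym (begin
  suc c ^ n ∸ 1                     ≡⟨ cong (_∸ 1) (geomSum-*-pred+1 c n) ⟨
  geomSum (suc c) n * c + 1 ∸ 1     ≡⟨ m+n∸n≡m _ 1 ⟩
  geomSum (suc c) n * c             ∎)
  where open ≡-Reasoning

∣geomSum⇒∣^∸1 : ∀ {d} p n → d ∣ geomSum p n → d ∣ p ^ n ∸ 1
∣geomSum⇒∣^∸1 {d} p n d∣G = subst (d ∣_) (geomSum-*-pred p n) (∣m⇒∣m*n (p ∸ 1) d∣G)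

geomSum-+ : ∀ p m n → geomSum p (m + n) ≡ p ^ n * geomSum p m + geomSum p n
geomSum-+ p zero n = cong (_+ geomSum p n) (sym (*-zeroʳ (p ^ n)))
geomSum-+ p (suc m) n = begin
  p ^ (m + n) + geomSum p (m + n)
    ≡⟨ cong₂ _+_ (^-distribˡ-+-* p m n) (geomSum-+ p m n) ⟩
  p ^ m * p ^ n + (p ^ n * geomSum p m + geomSum p n)
    ≡⟨ cong (_+ (p ^ n * geomSum p m + geomSum p n)) (*-comm (p ^ m) (p ^ n)) ⟩
  p ^ n * p ^ m + (p ^ n * geomSum p m + geomSum p n)
    ≡⟨ +-assoc (p ^ n * p ^ m) _ _ ⟨
  p ^ n * p ^ m + p ^ n * geomSum p m + geomSum p n
    ≡⟨ cong (_+ geomSum p n) (*-distribˡ-+ (p ^ n) (p ^ m) _) ⟨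
  p ^ n * (p ^ m + geomSum p m) + geomSum p n
    ∎
  where open ≡-Reasoning

geomSum-suc : ∀ p n → geomSum p (suc n) ≡ 1 + p * geomSum p n
geomSum-suc p n = begin
  geomSum p (suc n)               ≡⟨ cong (geomSum p) (+-comm 1 n) ⟩
  geomSum p (n + 1)               ≡⟨ geomSum-+ p n 1 ⟩
  p ^ 1 * geomSum p n + 1         ≡⟨ cong (λ x → x * geomSum p n + 1) (*-identityʳ p) ⟩
  p * geomSum p n + 1             ≡⟨ +-comm _ 1 ⟩
  1 + p * geomSum p n             ∎
  where open ≡-Reasoning

geomSum-mono-∣ : ∀ p {m n} → m ∣ n → geomSum p m ∣ geomSum p n
geomSum-mono-∣ p (divides zero refl) = _ ∣0
geomSum-mono-∣ p {m} (divides (suc k) refl) =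
  subst (geomSum p m ∣_) (sym (geomSum-+ p m (k * m)))
    (∣m∣n⇒∣m+n (∣n⇒∣m*n (p ^ (k * m)) ∣-refl) (geomSum-mono-∣ p (divides k refl)))

geomSum-monoˡ-≤ : ∀ {p q} n → p ≤ q → geomSum p n ≤ geomSum q n
geomSum-monoˡ-≤ zero p≤q = z≤n
geomSum-monoˡ-≤ (suc n) p≤q = +-mono-≤ (^-monoˡ-≤ n p≤q) (geomSum-monoˡ-≤ n p≤q)

square≤geomSum-2 : ∀ n → 5 ≤ n → n * n ≤ geomSum 2 n
square≤geomSum-2 (suc n) (s≤s 4≤n) with n ≟ 4
... | yes refl = ≤ᵇ⇒≤ 25 31 _
... | no n≢4 = begin
  suc n * suc n           ≡⟨ square-suc n ⟩
  suc (n + n + n * n)     ≤⟨ s≤s (+-monoˡ-≤ (n * n) 2n≤n²) ⟩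
  suc (n * n + n * n)     ≤⟨ s≤s (+-mono-≤ ih ih) ⟩
  suc (G + G)             ≡⟨ cong (λ x → suc (G + x)) (+-identityʳ G) ⟨
  1 + 2 * G               ≡⟨ geomSum-suc 2 n ⟨
  geomSum 2 (suc n)       ∎
  where
  open ≤-Reasoning
  G = geomSum 2 n
  square-suc : ∀ x → suc x * suc x ≡ suc (x + x + x * x)
  square-suc = solve 1 (λ x → (con 1 :+ x) :* (con 1 :+ x) := con 1 :+ (x :+ x :+ x :* x)) refl
  ih : n * n ≤ G
  ih = square≤geomSum-2 n (≤∧≢⇒< 4≤n (≢-sym n≢4))
  2n≤n² : n + n ≤ n * n
  2n≤n² = subst (_≤ n * n) (cong (n +_) (+-identityʳ n))
    (*-monoˡ-≤ n (≤-trans (≤ᵇ⇒≤ 2 4 _) 4≤n))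

module _ {n : ℕ} .{{_ : NonZero n}} where

  %-cong-+ : ∀ {x x′ y y′} → x % n ≡ x′ % n → y % n ≡ y′ % n → (x + y) % n ≡ (x′ + y′) % n
  %-cong-+ {x} {x′} {y} {y′} x≡x′ y≡y′ = begin
    (x + y) % n                 ≡⟨ %-distribˡ-+ x y n ⟩
    (x % n + y % n) % n         ≡⟨ cong₂ (λ a b → (a + b) % n) x≡x′ y≡y′ ⟩
    (x′ % n + y′ % n) % n       ≡⟨ %-distribˡ-+ x′ y′ n ⟨
    (x′ + y′) % n               ∎
    where open ≡-Reasoning

  %-cong-* : ∀ {x x′ y y′} → x % n ≡ x′ % n → y % n ≡ y′ % n → (x * y) % n ≡ (x′ * y′) % n
  %-cong-* {x} {x′} {y} {y′} x≡x′ y≡y′ = begin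
    (x * y) % n                 ≡⟨ %-distribˡ-* x y n ⟩
    (x % n * (y % n)) % n       ≡⟨ cong₂ (λ a b → (a * b) % n) x≡x′ y≡y′ ⟩
    (x′ % n * (y′ % n)) % n     ≡⟨ %-distribˡ-* x′ y′ n ⟨
    (x′ * y′) % n               ∎
    where open ≡-Reasoning

  ^-%≡1 : ∀ {x} k → x % n ≡ 1 % n → x ^ k % n ≡ 1 % n
  ^-%≡1 zero    x≡1 = refl
  ^-%≡1 (suc k) x≡1 = %-cong-* x≡1 (^-%≡1 k x≡1)

  geomSum-%≡ : ∀ {p} k → p % n ≡ 1 % n → geomSum p k % n ≡ k % n
  geomSum-%≡ zero    p≡1 = refl
  geomSum-%≡ (suc k) p≡1 = %-cong-+ (^-%≡1 k p≡1) (geomSum-%≡ k p≡1)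

  ^-multiple-%≡1 : ∀ p a v → p ^ a % n ≡ 1 % n → p ^ (v * a) % n ≡ 1 % n
  ^-multiple-%≡1 p a v pᵃ≡1 =
    subst (λ e → e % n ≡ 1 % n) (trans (^-*-assoc p a v) (cong (p ^_) (*-comm a v))) (^-%≡1 v pᵃ≡1)

  Bézout-%≡1 : ∀ p {a b u v} → p ^ a % n ≡ 1 % n → p ^ b % n ≡ 1 % n → 1 + u * b ≡ v * a → p % n ≡ 1 % n
  Bézout-%≡1 p {a} {b} {u} {v} pᵃ≡1 pᵇ≡1 1+ub≡va = begin
    p % n               ≡⟨ cong (_% n) (*-identityʳ p) ⟨
    (p * 1) % n         ≡⟨ %-cong-* {p} refl (^-multiple-%≡1 p b u pᵇ≡1) ⟨
    p ^ (1 + u * b) % n ≡⟨ cong (λ e → p ^ e % n) 1+ub≡va ⟩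
    p ^ (v * a) % n     ≡⟨ ^-multiple-%≡1 p a v pᵃ≡1 ⟩
    1 % n               ∎
    where open ≡-Reasoning

  coprime-exponents⇒%≡1 : ∀ p {a b} → Coprime a b → p ^ a % n ≡ 1 % n → p ^ b % n ≡ 1 % n → p % n ≡ 1 % n
  coprime-exponents⇒%≡1 p {a} {b} a⊥b pᵃ≡1 pᵇ≡1 with coprime-Bézout a⊥b
  ... | Bézout.+- x y eq = Bézout-%≡1 p {a} {b} {y} {x} pᵃ≡1 pᵇ≡1 eq
  ... | Bézout.-+ x y eq = Bézout-%≡1 p {b} {a} {x} {y} pᵇ≡1 pᵃ≡1 eq

  ∣∸1⇒%≡1 : ∀ {x} → 1 ≤ x → n ∣ x ∸ 1 → x % n ≡ 1 % n
  ∣∸1⇒%≡1 {suc x} _ n∣x = %-remove-+ʳ 1 n∣x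

  %≡⇒∣∸ : ∀ x y → x % n ≡ y % n → n ∣ y ∸ x
  %≡⇒∣∸ x y x≡y = divides (y / n ∸ x / n) (begin
    y ∸ x                                         ≡⟨ cong₂ _∸_ (m≡m%n+[m/n]*n y n) (m≡m%n+[m/n]*n x n) ⟩
    (y % n + y / n * n) ∸ (x % n + x / n * n)     ≡⟨ cong (λ r → (y % n + y / n * n) ∸ (r + x / n * n)) x≡y ⟩
    (y % n + y / n * n) ∸ (y % n + x / n * n)     ≡⟨ [m+n]∸[m+o]≡n∸o (y % n) _ _ ⟩
    y / n * n ∸ x / n * n                         ≡⟨ *-distribʳ-∸ n (y / n) (x / n) ⟨
    (y / n ∸ x / n) * n                           ∎)
    where open ≡-Reasoning

coprime-∣ : ∀ {a b c d} → Coprime a b → c ∣ a → d ∣ b → Coprime c d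
coprime-∣ a⊥b c∣a d∣b (e∣c , e∣d) = a⊥b (∣-trans e∣c c∣a , ∣-trans e∣d d∣b)

coprime-*ʳ : ∀ {n a b} → Coprime n a → Coprime n b → Coprime n (a * b)
coprime-*ʳ n⊥a n⊥b (c∣n , c∣ab) = n⊥b (c∣n , coprime-divisor (coprime-∣ n⊥a c∣n ∣-refl) c∣ab)

coprime-^ʳ : ∀ {n a} → Coprime n a → ∀ k → Coprime n (a ^ k)
coprime-^ʳ n⊥a zero    (_ , c∣1) = ∣1⇒≡1 c∣1
coprime-^ʳ n⊥a (suc k) = coprime-*ʳ n⊥a (coprime-^ʳ n⊥a k)

gcd≤1⇒coprime : ∀ {a b} .{{_ : NonZero b}} → gcd a b ≤ 1 → Coprime a b
gcd≤1⇒coprime {a} {b} gcd≤1 =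
  gcd≡1⇒coprime (≤-antisym gcd≤1 (n≢0⇒n>0 (gcd[m,n]≢0 a b (inj₂ (≢-nonZero⁻¹ b)))))

∣^∸1⇒coprime : ∀ {n p} k .{{_ : NonZero k}} .{{_ : NonZero p}} → n ∣ p ^ k ∸ 1 → Coprime n p
∣^∸1⇒coprime {p = p} k@(suc k-1) n∣pᵏ∸1 {c} (c∣n , c∣p) = ∣1⇒≡1 (∣m+n∣m⇒∣n c∣pᵏ∸1+1 (∣-trans c∣n n∣pᵏ∸1))
  where
  c∣pᵏ∸1+1 : c ∣ p ^ k ∸ 1 + 1
  c∣pᵏ∸1+1 = subst (c ∣_) (sym (m∸n+n≡m (m^n>0 p k))) (∣m⇒∣m*n (p ^ k-1) c∣p)

pigeonhole-^ : ∀ {n} p .{{_ : NonZero n}} → Coprime n p → ∃ λ d → 1 ≤ d × d ≤ n × n ∣ p ^ d ∸ 1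
pigeonhole-^ {n} p n⊥p with pigeonhole (n<1+n n) (λ i → fromℕ< (m%n<n (p ^ toℕ i) n))
... | i , j , i<j , residues≡ = d , m<n⇒0<n∸m i<j , ≤-trans (m∸n≤m b a) (toℕ≤pred[n] j) , n∣pᵈ∸1
  where
  a = toℕ i
  b = toℕ j
  d = b ∸ a
  pᵃ≡pᵇ : p ^ a % n ≡ p ^ b % n
  pᵃ≡pᵇ = trans (sym (toℕ-fromℕ< _)) (trans (cong toℕ residues≡) (toℕ-fromℕ< _))
  pᵇ∸pᵃ≡pᵃ[pᵈ∸1] : p ^ b ∸ p ^ a ≡ p ^ a * (p ^ d ∸ 1)
  pᵇ∸pᵃ≡pᵃ[pᵈ∸1] = begin
    p ^ b ∸ p ^ a           ≡⟨ cong (λ e → p ^ e ∸ p ^ a) (m+[n∸m]≡n (<⇒≤ i<j)) ⟨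
    p ^ (a + d) ∸ p ^ a     ≡⟨ cong₂ _∸_ (^-distribˡ-+-* p a d) (sym (*-identityʳ (p ^ a))) ⟩
    p ^ a * p ^ d ∸ p ^ a * 1 ≡⟨ *-distribˡ-∸ (p ^ a) (p ^ d) 1 ⟨
    p ^ a * (p ^ d ∸ 1)     ∎
    where open ≡-Reasoning
  n∣pᵈ∸1 : n ∣ p ^ d ∸ 1
  n∣pᵈ∸1 = coprime-divisor (coprime-^ʳ n⊥p a) (subst (n ∣_) pᵇ∸pᵃ≡pᵃ[pᵈ∸1] (%≡⇒∣∸ _ _ pᵃ≡pᵇ))

prime-exponent⇒%≡1 : ∀ {p ℓ s} .{{_ : NonZero p}} .{{_ : NonZero s}} →
                     Prime ℓ → s < ℓ → s ∣ p ^ ℓ ∸ 1 → p % s ≡ 1 % s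
prime-exponent⇒%≡1 {p} {ℓ} prime[ℓ] s<ℓ s∣pˡ∸1
  with d , 1≤d , d≤s , s∣pᵈ∸1 ← pigeonhole-^ p (∣^∸1⇒coprime ℓ {{prime⇒nonZero prime[ℓ]}} s∣pˡ∸1)
  = coprime-exponents⇒%≡1 p (prime⇒coprime prime[ℓ] {{>-nonZero 1≤d}} (≤-<-trans d≤s s<ℓ))
      (∣∸1⇒%≡1 (m^n>0 p ℓ) s∣pˡ∸1) (∣∸1⇒%≡1 (m^n>0 p d) s∣pᵈ∸1)

geomSum-prime-∤ : ∀ {p ℓ s} .{{_ : NonZero p}} → Prime ℓ → 1 < s → s < ℓ → s ∤ geomSum p ℓ
geomSum-prime-∤ {p} {ℓ} {s} prime[ℓ] 1<s s<ℓ s∣G = prime⇒¬composite prime[ℓ] (composite s<ℓ s∣ℓ)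
  where
  instance
    s-nonTrivial : NonTrivial s
    s-nonTrivial = n>1⇒nonTrivial 1<s
    s-nonZero : NonZero s
    s-nonZero = nonTrivial⇒nonZero s
  s∣ℓ : s ∣ ℓ
  s∣ℓ = m%n≡0⇒n∣m ℓ s (begin
    ℓ % s            ≡⟨ geomSum-%≡ {s} ℓ (prime-exponent⇒%≡1 prime[ℓ] s<ℓ (∣geomSum⇒∣^∸1 p ℓ s∣G)) ⟨
    geomSum p ℓ % s  ≡⟨ n∣m⇒m%n≡0 _ s s∣G ⟩
    0                ∎)
    where open ≡-Reasoning

Exceptional : ℕ → ℕ → Set
Exceptional p ℓ = p ≡ 2 × (ℓ ≡ 4 ⊎ ℓ ≡ 6 ⊎ ℓ ≡ 8 ⊎ ℓ ≡ 9)

ProperDivisorBound : ℕ → ℕ → ℕ → Set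
ProperDivisorBound p ℓ s = ∀ {a} → a ∣ ℓ → a < ℓ → geomSum p a ≤ s

proper-divisor-bound-via : ∀ {p ℓ s} q a → q ≤ p → a ∣ ℓ → a < ℓ → ℓ ≤ geomSum q a →
                           ProperDivisorBound p ℓ s → ℓ ≤ s
proper-divisor-bound-via q a q≤p a∣ℓ a<ℓ ℓ≤Gₐ bound =
  ≤-trans ℓ≤Gₐ (≤-trans (geomSum-monoˡ-≤ a q≤p) (bound a∣ℓ a<ℓ))

composite⇒balanced-factorisation : ∀ {n} → Composite n → ∃₂ λ x y → 2 ≤ y × y ≤ x × n ≡ x * y
composite⇒balanced-factorisation (composite {d} d<n d∣n) with ≤-total (quotient d∣n) d
... | inj₁ k≤d = d , quotient d∣n , quotient>1 d∣n d<n , k≤d , trans (m∣n⇒n≡quotient*m d∣n) (*-comm _ d)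
... | inj₂ d≤k = quotient d∣n , d , nonTrivial⇒n>1 d , d≤k , m∣n⇒n≡quotient*m d∣n

balanced-factorisation-bound : ∀ q x y {s} → 2 ≤ y → y ≤ x → ProperDivisorBound (2 + q) (x * y) s →
                               x * y ≤ s ⊎ Exceptional (2 + q) (x * y)
balanced-factorisation-bound q x@(suc (suc (suc (suc (suc _))))) y 2≤y y≤x bound =
  inj₁ (proper-divisor-bound-via 2 x (m≤m+n 2 q) (m∣m*n y) (m<m*n x y 2≤y) xy≤G bound)
  where
  xy≤G : x * y ≤ geomSum 2 x
  xy≤G = ≤-trans (*-monoʳ-≤ x y≤x) (square≤geomSum-2 x (m≤m+n 5 _))
balanced-factorisation-bound zero    2 2 _ _ _ = inj₂ (refl , inj₁ refl)
balanced-factorisation-bound (suc q) 2 2 _ _ bound =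
  inj₁ (proper-divisor-bound-via 3 2 (m≤m+n 3 q) (divides 2 refl) (≤ᵇ⇒≤ _ _ _) (≤ᵇ⇒≤ _ _ _) bound)
balanced-factorisation-bound q       3 2 _ _ bound =
  inj₁ (proper-divisor-bound-via 2 3 (m≤m+n 2 q) (divides 2 refl) (≤ᵇ⇒≤ _ _ _) (≤ᵇ⇒≤ _ _ _) bound)
balanced-factorisation-bound zero    3 3 _ _ _ = inj₂ (refl , inj₂ (inj₂ (inj₂ refl)))
balanced-factorisation-bound (suc q) 3 3 _ _ bound =
  inj₁ (proper-divisor-bound-via 3 3 (m≤m+n 3 q) (divides 3 refl) (≤ᵇ⇒≤ _ _ _) (≤ᵇ⇒≤ _ _ _) bound)
balanced-factorisation-bound q       4 2 _ _ bound =
  inj₁ (proper-divisor-bound-via 2 4 (m≤m+n 2 q) (divides 2 refl) (≤ᵇ⇒≤ _ _ _) (≤ᵇ⇒≤ _ _ _) bound)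
balanced-factorisation-bound q       4 3 _ _ bound =
  inj₁ (proper-divisor-bound-via 2 4 (m≤m+n 2 q) (divides 3 refl) (≤ᵇ⇒≤ _ _ _) (≤ᵇ⇒≤ _ _ _) bound)
balanced-factorisation-bound q       4 4 _ _ bound =
  inj₁ (proper-divisor-bound-via 2 8 (m≤m+n 2 q) (divides 2 refl) (≤ᵇ⇒≤ _ _ _) (≤ᵇ⇒≤ _ _ _) bound)
balanced-factorisation-bound _ 2 (suc (suc (suc _))) _ (s≤s (s≤s ())) _
balanced-factorisation-bound _ 3 (suc (suc (suc (suc _)))) _ (s≤s (s≤s (s≤s ()))) _
balanced-factorisation-bound _ 4 (suc (suc (suc (suc (suc _))))) _ (s≤s (s≤s (s≤s (s≤s ())))) _
balanced-factorisation-bound _ _ 0 () _ _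
balanced-factorisation-bound _ _ 1 (s≤s ()) _ _
balanced-factorisation-bound _ 0 (suc (suc _)) _ () _
balanced-factorisation-bound _ 1 (suc (suc _)) _ (s≤s ()) _

composite-exponent-bound : ∀ q {ℓ s} → Composite ℓ → ProperDivisorBound (2 + q) ℓ s →
                           ℓ ≤ s ⊎ Exceptional (2 + q) ℓ
composite-exponent-bound q composite[ℓ] bound
  with x , y , 2≤y , y≤x , refl ← composite⇒balanced-factorisation composite[ℓ]
  = balanced-factorisation-bound q x y 2≤y y≤x bound

gcd[pˡ∸1,m]∣geomSum : ∀ p ℓ m → gcd (p ∸ 1) m ≡ 1 → gcd (p ^ ℓ ∸ 1) m ∣ geomSum p ℓ
gcd[pˡ∸1,m]∣geomSum p ℓ m gcd[p∸1,m]≡1 = coprime-divisor M⊥p∸1 M∣[p∸1]G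
  where
  M = gcd (p ^ ℓ ∸ 1) m
  M⊥p∸1 : Coprime M (p ∸ 1)
  M⊥p∸1 = coprime-∣ (coprime-sym (gcd≡1⇒coprime gcd[p∸1,m]≡1)) (gcd[m,n]∣n (p ^ ℓ ∸ 1) m) ∣-refl
  M∣[p∸1]G : M ∣ (p ∸ 1) * geomSum p ℓ
  M∣[p∸1]G = subst (M ∣_) (trans (sym (geomSum-*-pred p ℓ)) (*-comm (geomSum p ℓ) (p ∸ 1)))
               (gcd[m,n]∣m (p ^ ℓ ∸ 1) m)

geomSum-∣-cofactor : ∀ {p m ℓ s} a .{{_ : NonZero m}} → a ∣ ℓ → gcd (p ^ a ∸ 1) m ≤ 1 →
                     s * gcd (p ^ ℓ ∸ 1) m ≡ geomSum p ℓ → geomSum p a ∣ s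
geomSum-∣-cofactor {p} {m} {ℓ} {s} a a∣ℓ gcd[pᵃ∸1,m]≤1 sM≡G = coprime-divisor Gₐ⊥M Gₐ∣Ms
  where
  M = gcd (p ^ ℓ ∸ 1) m
  Gₐ⊥M : Coprime (geomSum p a) M
  Gₐ⊥M = coprime-∣ (gcd≤1⇒coprime gcd[pᵃ∸1,m]≤1) (∣geomSum⇒∣^∸1 p a ∣-refl) (gcd[m,n]∣n (p ^ ℓ ∸ 1) m)
  Gₐ∣Ms : geomSum p a ∣ M * s
  Gₐ∣Ms = subst (geomSum p a ∣_) (trans (sym sM≡G) (*-comm s M)) (geomSum-mono-∣ p a∣ℓ)

lemma5p8 : (p m ℓ : ℕ) → Prime p → 3 ≤ m → gcd p m ≡ 1 → gcd (p ∸ 1) m ≡ 1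
    → 1 ≤ ℓ → 1 < gcd (p ^ ℓ ∸ 1) m
    → (∀ e → 1 ≤ e → e < ℓ → gcd (p ^ e ∸ 1) m ≤ 1)
    → (gcd (p ^ ℓ ∸ 1) m ∣ geomSum p ℓ)
      × (∀ s → s * gcd (p ^ ℓ ∸ 1) m ≡ geomSum p ℓ → 1 < s
          → ℓ ≤ s ⊎ (p ≡ 2 × (ℓ ≡ 4 ⊎ ℓ ≡ 6 ⊎ ℓ ≡ 8 ⊎ ℓ ≡ 9)))
lemma5p8 0 _ _ prime[0] = ⊥-elim (¬prime[0] prime[0])
lemma5p8 1 _ _ prime[1] = ⊥-elim (¬prime[1] prime[1])
lemma5p8 p@(suc (suc q)) m ℓ _ 3≤m _ gcd[p∸1,m]≡1 _ _ minimal = gcd[pˡ∸1,m]∣geomSum p ℓ m gcd[p∸1,m]≡1 , bound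
  where
  instance
    m-nonZero : NonZero m
    m-nonZero = >-nonZero (≤-trans z<s 3≤m)
  bound : ∀ s → s * gcd (p ^ ℓ ∸ 1) m ≡ geomSum p ℓ → 1 < s → ℓ ≤ s ⊎ Exceptional p ℓ
  bound s sM≡G 1<s with ℓ ≤? s | prime? ℓ
  ... | yes ℓ≤s | _            = inj₁ ℓ≤s
  ... | no ℓ≰s  | yes prime[ℓ] = ⊥-elim (geomSum-prime-∤ prime[ℓ] 1<s (≰⇒> ℓ≰s) (subst (s ∣_) sM≡G (m∣m*n _)))
  ... | no ℓ≰s  | no ¬prime[ℓ] = composite-exponent-bound q composite[ℓ] proper-divisor-bound
    where
    composite[ℓ] : Composite ℓ
    composite[ℓ] = ¬prime⇒composite {{n>1⇒nonTrivial (<-trans 1<s (≰⇒> ℓ≰s))}} ¬prime[ℓ]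
    proper-divisor-bound : ProperDivisorBound p ℓ s
    proper-divisor-bound {zero}      _   _   = z≤n
    proper-divisor-bound {a@(suc _)} a∣ℓ a<ℓ =
      ∣⇒≤ {{>-nonZero (<-trans z<s 1<s)}} (geomSum-∣-cofactor a a∣ℓ (minimal a z<s a<ℓ) sM≡G)
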